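{- Let $a\in\mathbb{N}$, $a\ge3$, $S=\langle a,a+1,a+2\rangle$ and $r\in\mathbb{N}$. The following are equivalent: (i) $r\in S$; (ii) $\varepsilon_r\le 2\ell_r$; (iii) $\phi_r\in\mathbb{N}^3$; (iv) there exist $u,v\in\mathbb{N}$ with $v\le 2u$ and $r=au+v$. In that case $\phi_r\in\operatorname{F}(r,S)$. Suppose moreover that $r\in S\cap\llbracket 0,\mathscr{L}_a)\!)$ (so that $\operatorname{L}(r,S)=\{\ell_r\}$). Then: (1) if $u,v\in\mathbb{N}$ satisfy $v\le 2u$ and $r=au+v$, then $(u,v)=(\ell_r,\varepsilon_r)$; (2) $\operatorname{F}(r,S)=\{\phi_r+j\omega:0\le j\le\kappa_r\}$; (3) $\mathcal{B}_r=\{\mathrm{m}^{\phi_r+j\omega}:0\le j\le\kappa_r\}$ is a basis of $W_r$; in particular $\delta_r=\kappa_r+1$; (4) $\ell_r=2(\delta_r-1)+\iota_r$; in particular $\ell_r$ and $\iota_r$ have the same parity and $0\le\iota_r\le\ell_r$.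
   Context: $\mathbb{N}=\{0,1,2,\dots\}$. $S=\langle a,a+1,a+2\rangle=\{\alpha_1a+\alpha_2(a+1)+\alpha_3(a+2):\alpha_i\in\mathbb{N}\}$. $\operatorname{F}(r,S)=\{\alpha\in\mathbb{N}^3:\alpha_1a+\alpha_2(a+1)+\alpha_3(a+2)=r\}$, $|\alpha|=\alpha_1+\alpha_2+\alpha_3$, $\operatorname{L}(r,S)=\{|\alpha|:\alpha\in\operatorname{F}(r,S)\}$. $\mathscr{L}_a=\lfloor a/2\rfloor (a+2)$ if $a$ is even, and $\mathscr{L}_a=(\lfloor a/2\rfloor+2)a$ if $a$ is odd; $\llbracket x,y)\!)=\{n\in\mathbb{Z}:x\le n<y\}$. For $r\in\mathbb{N}$: $\ell_r=\lfloor r/a\rfloor$, $\varepsilon_r=r-a\ell_r$ (remainder of $r$ mod $a$), and the seed vector $\phi_r=(\phi_{r,1},\phi_{r,2},\phi_{r,3})=(\ell_r-\lfloor(\varepsilon_r+1)/2\rfloor,\ \varepsilon_r-2\lfloor\varepsilon_r/2\rfloor,\ \lfloor\varepsilon_r/2\rfloor)\in\mathbb{Z}^3$. When $\phi_r\in\mathbb{N}^3$: $\kappa_r=\min(\phi_{r,1},\phi_{r,3})$ and $\iota_r=\phi_{r,2}+|\phi_{r,1}-\phi_{r,3}|$. $\omega=(-1,2,-1)$. Let $\mathbb{K}$ be a field and $x,y,z$ variables; for $\alpha\in\mathbb{N}^3$, $\mathrm{m}^\alpha=x^{\alpha_1}y^{\alpha_2}z^{\alpha_3}$. For $r\in S$,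 $W_r$ is the $\mathbb{K}$-vector space spanned by $\{\mathrm{m}^\alpha:\alpha\in\operatorname{F}(r,S)\}$ and $\delta_r=\dim_{\mathbb{K}}W_r$. -}

module Defs where

open import Level using (Level; _⊔_) renaming (suc to lsuc)
open import Data.Nat using (ℕ; zero; suc; _+_; _*_; _∸_; _≤_; _⊓_; ∣_-_∣; NonZero)
open import Data.Nat.DivMod using (_/_; _%_)
open import Data.Nat.Properties using (_≟_)
open import Data.Integer as ℤ using (ℤ; +_)
open import Data.Product using (Σ; ∃; _×_; _,_; proj₁; proj₂)
open import Data.Fin using (Fin; toℕ)
open import Data.List using (List; []; _∷_)
open import Relation.Binary.PropositionalEquality using (_≡_)
open import Relation.Nullary using (¬_; yes; no)
open import Algebra.Bundles using (CommutativeRing)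

record Field (c ℓ : Level) : Set (lsuc (c ⊔ ℓ)) where
  field
    commutativeRing : CommutativeRing c ℓ
  open CommutativeRing commutativeRing public
    renaming (_+_ to _+K_; _*_ to _*K_)
  field
    1≉0     : ¬ (1# ≈ 0#)
    inverse : ∀ x → ¬ (x ≈ 0#) → Σ Carrier λ y → x *K y ≈ 1#

ℕ³ : Set
ℕ³ = ℕ × ℕ × ℕ

ℤ³ : Set
ℤ³ = ℤ × ℤ × ℤ

toℤ³ : ℕ³ → ℤ³
toℤ³ (x , y , z) = (+ x , + y , + z)

InN³ : ℤ³ → Set
InN³ φ = Σ ℕ³ λ α → toℤ³ α ≡ φ

_∈F[_]_ : ℕ³ → ℕ → ℕ → Set
(α₁ , α₂ , α₃) ∈F[ a ] r = α₁ * a + α₂ * (a + 1) + α₃ * (a + 2) ≡ r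

InS : ℕ → ℕ → Set
InS a r = Σ ℕ³ λ α → α ∈F[ a ] r

ℓ : (a : ℕ) .{{_ : NonZero a}} → ℕ → ℕ
ℓ a r = r / a

ε : (a : ℕ) .{{_ : NonZero a}} → ℕ → ℕ
ε a r = r % a

φ : (a : ℕ) .{{_ : NonZero a}} → ℕ → ℤ³
φ a r = ( + ℓ a r ℤ.- + ((ε a r + 1) / 2)
        , + (ε a r ∸ 2 * (ε a r / 2))
        , + (ε a r / 2) )

-- κ and ι, for a seed vector already known to lie in ℕ³
κ : ℕ³ → ℕ
κ (α₁ , α₂ , α₃) = α₁ ⊓ α₃

ι : ℕ³ → ℕ
ι (α₁ , α₂ , α₃) = α₂ + ∣ α₁ - α₃ ∣

_+_ω : ℤ³ → ℕ → ℤ³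
(x , y , z) + j ω = (x ℤ.- + j , y ℤ.+ + (2 * j) , z ℤ.- + j)

-- the same vector computed in ℕ³ (agrees with the above when j ≤ κ)
shift : ℕ³ → ℕ → ℕ³
shift (α₁ , α₂ , α₃) j = (α₁ ∸ j , α₂ + 2 * j , α₃ ∸ j)

𝓛sel : ℕ → ℕ → ℕ
𝓛sel zero    a = (a / 2) * (a + 2)
𝓛sel (suc _) a = (a / 2 + 2) * a

𝓛 : ℕ → ℕ
𝓛 a = 𝓛sel (a % 2) a

-- Polynomials in K[x,y,z], represented by their coefficient functions
-- ℕ³ → K; a polynomial is given by a finite list of terms (c, α)
-- standing for Σ c·m^α.

module Poly {c ℓ′ : Level} (K : Field c ℓ′) where
  open Field K

  mono : ℕ³ → ℕ³ → Carrier
  mono (α₁ , α₂ , α₃) (γ₁ , γ₂ , γ₃) with α₁ ≟ γ₁ | α₂ ≟ γ₂ | α₃ ≟ γ₃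
  ... | yes _ | yes _ | yes _ = 1#
  ... | _     | _     | _     = 0#

  coeff : List (Carrier × ℕ³) → ℕ³ → Carrier
  coeff []             γ = 0#
  coeff ((k , α) ∷ ts) γ = k *K mono α γ +K coeff ts γ

  sumFin : (n : ℕ) → (Fin n → Carrier) → Carrier
  sumFin zero    f = 0#
  sumFin (suc n) f = f Fin.zero +K sumFin n (λ i → f (Fin.suc i))
    where import Data.Fin as Fin

  combo : (n : ℕ) → (Fin n → Carrier) → (Fin n → ℕ³) → ℕ³ → Carrier
  combo n cs b γ = sumFin n (λ j → cs j *K mono (b j) γ)

  -- The family b : Fin n → ℕ³ indexes a set of monomials that forms a
  -- basis of W_r = span{ m^α : α ∈ F(r,S) }:
  --   * each m^{b j} lies in W_r (b j ∈ F(r,S)),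
  --   * every element of W_r is a linear combination of the m^{b j},
  --   * the m^{b j} are linearly independent.
  IsMonomialBasisOfW : (a r n : ℕ) → (Fin n → ℕ³) → Set (c ⊔ ℓ′)
  IsMonomialBasisOfW a r n b =
    ((j : Fin n) → b j ∈F[ a ] r)
    × ((ts : List (Carrier × ℕ³)) →
         All (λ t → proj₂ t ∈F[ a ] r) ts →
         Σ (Fin n → Carrier) λ cs → ∀ γ → coeff ts γ ≈ combo n cs b γ)
    × ((cs : Fin n → Carrier) →
         (∀ γ → combo n cs b γ ≈ 0#) → ∀ j → cs j ≈ 0#)
    where open import Data.List.Relation.Unary.All using (All)

{-# OPTIONS --safe #-}

-- A factorization α of r satisfies r = a|α| + e(α), where the excess e(α) = α₂ + 2α₃ is at
-- most 2|α|. Hence r ∈ S iff r = au + v with v ≤ 2u, and φ_r is the vector of length ℓ_r and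
-- excess ε_r whose middle entry is ε_r mod 2. If v ≥ a then au + v ≥ 𝓛_a, so for r < 𝓛_a
-- uniqueness of Euclidean division gives every factorization length ℓ_r and excess ε_r.
-- Such a vector β is φ_r + jω with j = ⌊β₂/2⌋, so F(r,S) = {φ_r + jω}; monomials with
-- distinct exponents are linearly independent, which gives the basis.

module Submission where

open import Defs
open import Level using (Level)
open import Data.Nat using (ℕ; zero; suc; _+_; _*_; _∸_; _≤_; _<_; _⊓_; ∣_-_∣; NonZero; z≤n; s≤s; _<?_)
open import Data.Nat.Properties
open import Data.Nat.DivMod
open import Data.Nat.Divisibility using (m∣m*n)
open import Data.Nat.Tactic.RingSolver using (solve-∀)
open import Algebra.Properties.CommutativeSemigroup +-commutativeSemigroup using (x∙yz≈y∙xz)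
open import Data.Integer as ℤ using (+_)
import Data.Integer.Properties as ℤ
import Data.Integer.Tactic.RingSolver as ℤSolver
open import Data.Fin as Fin using (Fin; toℕ; fromℕ<; punchIn)
import Data.Fin.Properties as Fin
open import Data.Product using (Σ; ∃; _×_; _,_; proj₁; proj₂)
open import Data.Product.Properties using (≡-dec)
open import Data.List using ([]; _∷_)
open import Data.List.Relation.Unary.All using (All; []; _∷_)
open import Data.Empty using (⊥-elim)
open import Function using (_∘_)
open import Function.Bundles using (_⇔_; mk⇔; Equivalence)
open import Function.Definitions using (Injective)
open import Relation.Binary.Definitions using (DecidableEquality)
open import Relation.Binary.PropositionalEquality
open import Relation.Nullary using (yes; no)

open Equivalence using (to; from)

n*q/n≡q : ∀ n .{{_ : NonZero n}} q → n * q / n ≡ q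
n*q/n≡q n q = trans (/-congˡ (*-comm n q)) (m*n/n≡m q n)

[n*q+s]/n≡q : ∀ n .{{_ : NonZero n}} {q s} → s < n → (n * q + s) / n ≡ q
[n*q+s]/n≡q n {q} {s} s<n = begin
  (n * q + s) / n    ≡⟨ +-distrib-/-∣ˡ s (m∣m*n q) ⟩
  n * q / n + s / n  ≡⟨ cong₂ _+_ (n*q/n≡q n q) (m<n⇒m/n≡0 s<n) ⟩
  q + 0              ≡⟨ +-identityʳ q ⟩
  q                  ∎
  where open ≡-Reasoning

[n*q+s]%n≡s : ∀ n .{{_ : NonZero n}} {q s} → s < n → (n * q + s) % n ≡ s
[n*q+s]%n≡s n {q} {s} s<n = trans (%-remove-+ˡ s (m∣m*n q)) (m<n⇒m%n≡m s<n)

m≡n*[m/n]+m%n : ∀ m n .{{_ : NonZero n}} → m ≡ n * (m / n) + m % n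
m≡n*[m/n]+m%n m n =
  trans (m≡m%n+[m/n]*n m n) (trans (+-comm (m % n) _) (cong (_+ m % n) (*-comm (m / n) n)))

division-unique : ∀ n .{{_ : NonZero n}} {q q′ s s′} → s < n → s′ < n →
                  n * q + s ≡ n * q′ + s′ → q ≡ q′ × s ≡ s′
division-unique n s<n s′<n eq =
    trans (sym ([n*q+s]/n≡q n s<n)) (trans (/-congˡ eq) ([n*q+s]/n≡q n s′<n))
  , trans (sym ([n*q+s]%n≡s n s<n)) (trans (%-congˡ eq) ([n*q+s]%n≡s n s′<n))

[2h+s+1]/2≡h+s : ∀ h {s} → s < 2 → (2 * h + s + 1) / 2 ≡ h + s
[2h+s+1]/2≡h+s h {zero} _ = begin
  (2 * h + 0 + 1) / 2  ≡⟨ /-congˡ (cong (_+ 1) (+-identityʳ (2 * h))) ⟩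
  (2 * h + 1) / 2      ≡⟨ [n*q+s]/n≡q 2 (s≤s (s≤s z≤n)) ⟩
  h                    ≡⟨ +-identityʳ h ⟨
  h + 0                ∎
  where open ≡-Reasoning
[2h+s+1]/2≡h+s h {suc zero} _ = begin
  (2 * h + 1 + 1) / 2    ≡⟨ /-congˡ (2h+2≡2[h+1]+0 h) ⟩
  (2 * (h + 1) + 0) / 2  ≡⟨ [n*q+s]/n≡q 2 (s≤s z≤n) ⟩
  h + 1                  ∎
  where
  open ≡-Reasoning
  2h+2≡2[h+1]+0 : ∀ h → 2 * h + 1 + 1 ≡ 2 * (h + 1) + 0
  2h+2≡2[h+1]+0 = solve-∀
[2h+s+1]/2≡h+s h {suc (suc _)} (s≤s (s≤s ()))

half-≤ : ∀ {h s u} → s < 2 → 2 * h + s ≤ 2 * u → h + s ≤ u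
half-≤ {h} {zero} {u} _ le =
  subst (_≤ u) (sym (+-identityʳ h)) (*-cancelˡ-≤ 2 (subst (_≤ 2 * u) (+-identityʳ (2 * h)) le))
half-≤ {h} {suc zero} {u} _ le =
  subst (_≤ u) (+-comm 1 h) (*-cancelˡ-< 2 h u (subst (_≤ 2 * u) (+-comm (2 * h) 1) le))
half-≤ {s = suc (suc _)} (s≤s (s≤s ())) _

m+n≡2[m⊓n]+∣m-n∣ : ∀ m n → m + n ≡ 2 * (m ⊓ n) + ∣ m - n ∣
m+n≡2[m⊓n]+∣m-n∣ zero    n       = refl
m+n≡2[m⊓n]+∣m-n∣ (suc m) zero    = +-identityʳ (suc m)
m+n≡2[m⊓n]+∣m-n∣ (suc m) (suc n) = begin
  suc m + suc n                   ≡⟨ cong suc (+-suc m n) ⟩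
  2 + (m + n)                     ≡⟨ cong (λ t → 2 + t) (m+n≡2[m⊓n]+∣m-n∣ m n) ⟩
  2 + (2 * (m ⊓ n) + ∣ m - n ∣)   ≡⟨ +-assoc 2 (2 * (m ⊓ n)) ∣ m - n ∣ ⟨
  2 + 2 * (m ⊓ n) + ∣ m - n ∣     ≡⟨ cong (_+ ∣ m - n ∣) (*-suc 2 (m ⊓ n)) ⟨
  2 * suc (m ⊓ n) + ∣ m - n ∣     ∎
  where open ≡-Reasoning

+m≡+n-+k⇔m+k≡n : ∀ {m n k} → (+ m ≡ + n ℤ.- + k) ⇔ (m + k ≡ n)
+m≡+n-+k⇔m+k≡n {m} {n} {k} = mk⇔
  (λ eq → ℤ.+-injective (begin
    + (m + k)            ≡⟨ ℤ.pos-+ m k ⟩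
    + m ℤ.+ + k          ≡⟨ cong (ℤ._+ + k) eq ⟩
    + n ℤ.- + k ℤ.+ + k  ≡⟨ [i-j]+j≡i (+ n) (+ k) ⟩
    + n                  ∎))
  (λ eq → begin
    + m                  ≡⟨ i≡[i+j]-j (+ m) (+ k) ⟩
    + m ℤ.+ + k ℤ.- + k  ≡⟨ cong (ℤ._- + k) (ℤ.pos-+ m k) ⟨
    + (m + k) ℤ.- + k    ≡⟨ cong (λ t → + t ℤ.- + k) eq ⟩
    + n ℤ.- + k          ∎)
  where
  open ≡-Reasoning
  [i-j]+j≡i : ∀ i j → i ℤ.- j ℤ.+ j ≡ i
  [i-j]+j≡i = ℤSolver.solve-∀
  i≡[i+j]-j : ∀ i j → i ≡ i ℤ.+ j ℤ.- j
  i≡[i+j]-j = ℤSolver.solve-∀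

size : ℕ³ → ℕ
size (x , y , z) = x + y + z

excess : ℕ³ → ℕ
excess (x , y , z) = 2 * z + y

excess≤2*size : ∀ α → excess α ≤ 2 * size α
excess≤2*size (x , y , z) = begin
  2 * z + y                ≤⟨ m≤n+m (2 * z + y) (2 * x + y) ⟩
  2 * x + y + (2 * z + y)  ≡⟨ 2x+y+[2z+y]≡2[x+y+z] x y z ⟩
  2 * (x + y + z)          ∎
  where
  open ≤-Reasoning
  2x+y+[2z+y]≡2[x+y+z] : ∀ x y z → 2 * x + y + (2 * z + y) ≡ 2 * (x + y + z)
  2x+y+[2z+y]≡2[x+y+z] = solve-∀

∈F⇔≡a*size+excess : ∀ {a r} α → α ∈F[ a ] r ⇔ (r ≡ a * size α + excess α)
∈F⇔≡a*size+excess {a} (x , y , z) =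
  mk⇔ (λ α∈F → trans (sym α∈F) (value a x y z)) (λ r≡ → trans (value a x y z) (sym r≡))
  where
  value : ∀ a x y z → x * a + y * (a + 1) + z * (a + 2) ≡ a * (x + y + z) + (2 * z + y)
  value = solve-∀

size≡2κ+ι : ∀ α → size α ≡ 2 * κ α + ι α
size≡2κ+ι (x , y , z) = begin
  x + y + z                         ≡⟨ cong (_+ z) (+-comm x y) ⟩
  y + x + z                         ≡⟨ +-assoc y x z ⟩
  y + (x + z)                       ≡⟨ cong (λ t → y + t) (m+n≡2[m⊓n]+∣m-n∣ x z) ⟩
  y + (2 * (x ⊓ z) + ∣ x - z ∣)     ≡⟨ x∙yz≈y∙xz y (2 * (x ⊓ z)) ∣ x - z ∣ ⟩
  2 * (x ⊓ z) + (y + ∣ x - z ∣)     ∎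
  where open ≡-Reasoning

shift-size : ∀ {j} α → j ≤ κ α → size (shift α j) ≡ size α
shift-size {j} (x , y , z) j≤κ = begin
  x ∸ j + (y + 2 * j) + (z ∸ j)     ≡⟨ regroup (x ∸ j) y (z ∸ j) j ⟩
  (x ∸ j + j) + y + (z ∸ j + j)     ≡⟨ cong₂ (λ s t → s + y + t) (m∸n+n≡m (≤-trans j≤κ (m⊓n≤m x z)))
                                                                (m∸n+n≡m (≤-trans j≤κ (m⊓n≤n x z))) ⟩
  x + y + z                         ∎
  where
  open ≡-Reasoning
  regroup : ∀ s y t j → s + (y + 2 * j) + t ≡ (s + j) + y + (t + j)
  regroup = solve-∀

shift-excess : ∀ {j} α → j ≤ κ α → excess (shift α j) ≡ excess α
shift-excess {j} (x , y , z) j≤κ = begin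
  2 * (z ∸ j) + (y + 2 * j)   ≡⟨ regroup (z ∸ j) y j ⟩
  2 * (z ∸ j + j) + y         ≡⟨ cong (λ t → 2 * t + y) (m∸n+n≡m (≤-trans j≤κ (m⊓n≤n x z))) ⟩
  2 * z + y                   ∎
  where
  open ≡-Reasoning
  regroup : ∀ t y j → 2 * t + (y + 2 * j) ≡ 2 * (t + j) + y
  regroup = solve-∀

shift-∈F : ∀ {a r j} α → j ≤ κ α → α ∈F[ a ] r → shift α j ∈F[ a ] r
shift-∈F {a} {r} {j} α j≤κ α∈F = from (∈F⇔≡a*size+excess (shift α j)) (begin
  r                                      ≡⟨ to (∈F⇔≡a*size+excess α) α∈F ⟩
  a * size α + excess α                  ≡⟨ cong₂ (λ s e → a * s + e) (shift-size α j≤κ) (shift-excess α j≤κ) ⟨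
  a * size (shift α j) + excess (shift α j) ∎)
  where open ≡-Reasoning

toℤ³-shift : ∀ {j} α → j ≤ κ α → toℤ³ (shift α j) ≡ toℤ³ α + j ω
toℤ³-shift {j} (x , y , z) j≤κ =
  cong₂ _,_ (from +m≡+n-+k⇔m+k≡n (m∸n+n≡m (≤-trans j≤κ (m⊓n≤m x z))))
            (cong₂ _,_ (ℤ.pos-+ y (2 * j)) (from +m≡+n-+k⇔m+k≡n (m∸n+n≡m (≤-trans j≤κ (m⊓n≤n x z)))))

shift-injective : ∀ α {i j} → shift α i ≡ shift α j → i ≡ j
shift-injective (x , y , z) {i} {j} eq = *-cancelˡ-≡ i j 2 (+-cancelˡ-≡ y _ _ (cong (proj₁ ∘ proj₂) eq))

same-size-excess⇒shift : ∀ {x y z} β → y < 2 →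
                         size β ≡ size (x , y , z) → excess β ≡ excess (x , y , z) →
                         Σ ℕ λ j → j ≤ κ (x , y , z) × β ≡ shift (x , y , z) j
same-size-excess⇒shift {x} {y} {z} (b₁ , b₂ , b₃) y<2 size≡ excess≡ =
  q , ⊓-glb (subst (q ≤_) b₁+q≡x (m≤n+m q b₁)) (subst (q ≤_) q+b₃≡z (m≤m+n q b₃)) ,
  cong₂ _,_ (sym (trans (cong (_∸ q) (sym b₁+q≡x)) (m+n∸n≡m b₁ q)))
            (cong₂ _,_ b₂≡y+2q (sym (trans (cong (_∸ q) (sym q+b₃≡z)) (m+n∸m≡n q b₃))))
  where
  open ≡-Reasoning
  q = b₂ / 2
  b₂≡ : b₂ ≡ 2 * q + b₂ % 2
  b₂≡ = m≡n*[m/n]+m%n b₂ 2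
  regroup-excess : ∀ q s b₃ → 2 * (q + b₃) + s ≡ 2 * b₃ + (2 * q + s)
  regroup-excess = solve-∀
  halves : q + b₃ ≡ z × b₂ % 2 ≡ y
  halves = division-unique 2 (m%n<n b₂ 2) y<2
    (trans (regroup-excess q (b₂ % 2) b₃) (trans (cong (λ t → 2 * b₃ + t) (sym b₂≡)) excess≡))
  q+b₃≡z = proj₁ halves
  b₂≡y+2q : b₂ ≡ y + 2 * q
  b₂≡y+2q = trans b₂≡ (trans (cong (λ t → 2 * q + t) (proj₂ halves)) (+-comm (2 * q) y))
  regroup-size : ∀ b₁ y q b₃ → b₁ + (y + 2 * q) + b₃ ≡ (b₁ + q) + y + (q + b₃)
  regroup-size = solve-∀
  b₁+q≡x : b₁ + q ≡ x
  b₁+q≡x = +-cancelʳ-≡ y _ _ (+-cancelʳ-≡ (q + b₃) _ _ (begin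
    (b₁ + q) + y + (q + b₃)  ≡⟨ regroup-size b₁ y q b₃ ⟨
    b₁ + (y + 2 * q) + b₃    ≡⟨ cong (λ t → b₁ + t + b₃) b₂≡y+2q ⟨
    b₁ + b₂ + b₃             ≡⟨ size≡ ⟩
    x + y + z                ≡⟨ cong (λ t → x + y + t) q+b₃≡z ⟨
    x + y + (q + b₃)         ∎))

𝓛≡a*⌈a/2⌉+a : ∀ a → 𝓛 a ≡ a * (a / 2 + a % 2) + a
𝓛≡a*⌈a/2⌉+a a with a % 2 | m≡n*[m/n]+m%n a 2 | m%n<n a 2
... | zero | a≡ | _ = trans (even a (a / 2)) (cong (λ t → a * (a / 2 + 0) + t) (sym a≡))
  where
  even : ∀ a k → k * (a + 2) ≡ a * (k + 0) + (2 * k + 0)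
  even = solve-∀
... | suc zero | _ | _ = odd a (a / 2)
  where
  odd : ∀ a k → (k + 2) * a ≡ a * (k + 1) + a
  odd = solve-∀
... | suc (suc _) | _ | s≤s (s≤s ())

𝓛-least : ∀ {a u v} → a ≤ v → v ≤ 2 * u → 𝓛 a ≤ a * u + v
𝓛-least {a} {u} {v} a≤v v≤2u = begin
  𝓛 a                      ≡⟨ 𝓛≡a*⌈a/2⌉+a a ⟩
  a * (a / 2 + a % 2) + a  ≤⟨ +-mono-≤ (*-monoʳ-≤ a ⌈a/2⌉≤u) a≤v ⟩
  a * u + v                ∎
  where
  open ≤-Reasoning
  ⌈a/2⌉≤u : a / 2 + a % 2 ≤ u
  ⌈a/2⌉≤u = half-≤ (m%n<n a 2) (subst (_≤ 2 * u) (m≡n*[m/n]+m%n a 2) (≤-trans a≤v v≤2u))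

module _ (a : ℕ) .{{_ : NonZero a}} where

  r≡a*ℓ+ε : ∀ r → r ≡ a * ℓ a r + ε a r
  r≡a*ℓ+ε r = m≡n*[m/n]+m%n r a

  InS⇒representation : ∀ {r} → InS a r → Σ ℕ λ u → Σ ℕ λ v → v ≤ 2 * u × r ≡ a * u + v
  InS⇒representation (α , α∈F) = size α , excess α , excess≤2*size α , to (∈F⇔≡a*size+excess α) α∈F

  representation⇒ε≤2ℓ : ∀ {r} → (Σ ℕ λ u → Σ ℕ λ v → v ≤ 2 * u × r ≡ a * u + v) → ε a r ≤ 2 * ℓ a r
  representation⇒ε≤2ℓ {r} (u , v , v≤2u , r≡) = ≤-trans ε≤v (≤-trans v≤2u (*-monoʳ-≤ 2 u≤ℓ))
    where
    ε≤v : ε a r ≤ v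
    ε≤v = subst (_≤ v) (sym (trans (%-congˡ r≡) (%-remove-+ˡ v (m∣m*n u)))) (m%n≤m v a)
    u≤ℓ : u ≤ ℓ a r
    u≤ℓ = subst (_≤ ℓ a r) (n*q/n≡q a u) (/-monoˡ-≤ a (subst (a * u ≤_) (sym r≡) (m≤m+n (a * u) v)))

  representation-unique : ∀ {r u v} → r < 𝓛 a → v ≤ 2 * u → r ≡ a * u + v → u ≡ ℓ a r × v ≡ ε a r
  representation-unique {r} {u} {v} r<𝓛 v≤2u r≡ with v <? a
  ... | yes v<a = division-unique a v<a (m%n<n r a) (trans (sym r≡) (r≡a*ℓ+ε r))
  ... | no v≮a  = ⊥-elim (<⇒≱ r<𝓛 (subst (𝓛 a ≤_) (sym r≡) (𝓛-least (≮⇒≥ v≮a) v≤2u)))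

  φ≡ : ∀ r → φ a r ≡ (+ ℓ a r ℤ.- + (ε a r / 2 + ε a r % 2) , + (ε a r % 2) , + (ε a r / 2))
  φ≡ r = cong₂ _,_ (cong (λ t → + ℓ a r ℤ.- + t) ⌈ε/2⌉) (cong (λ t → + t , + (ε a r / 2)) ε∸2⌊ε/2⌋)
    where
    ⌈ε/2⌉ : (ε a r + 1) / 2 ≡ ε a r / 2 + ε a r % 2
    ⌈ε/2⌉ = trans (/-congˡ (cong (_+ 1) (m≡n*[m/n]+m%n (ε a r) 2))) ([2h+s+1]/2≡h+s (ε a r / 2) (m%n<n (ε a r) 2))
    ε∸2⌊ε/2⌋ : ε a r ∸ 2 * (ε a r / 2) ≡ ε a r % 2
    ε∸2⌊ε/2⌋ = sym (trans (m%n≡m∸m/n*n (ε a r) 2) (cong (ε a r ∸_) (*-comm (ε a r / 2) 2)))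

  toℤ³≡φ⇔ : ∀ r {x y z} → toℤ³ (x , y , z) ≡ φ a r ⇔
            (size (x , y , z) ≡ ℓ a r × excess (x , y , z) ≡ ε a r × y < 2)
  toℤ³≡φ⇔ r {x} {y} {z} = mk⇔ forward backward
    where
    open ≡-Reasoning
    h = ε a r / 2
    p = ε a r % 2
    p<2 : p < 2
    p<2 = m%n<n (ε a r) 2
    ε≡ : ε a r ≡ 2 * h + p
    ε≡ = m≡n*[m/n]+m%n (ε a r) 2
    reorder : ∀ x y z → x + (z + y) ≡ x + y + z
    reorder = solve-∀
    forward : toℤ³ (x , y , z) ≡ φ a r → size (x , y , z) ≡ ℓ a r × excess (x , y , z) ≡ ε a r × y < 2
    forward eq = size≡ , trans (cong₂ (λ s t → 2 * s + t) z≡h y≡p) (sym ε≡) , subst (_< 2) (sym y≡p) p<2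
      where
      eq′ = trans eq (φ≡ r)
      y≡p = ℤ.+-injective (cong (proj₁ ∘ proj₂) eq′)
      z≡h = ℤ.+-injective (cong (proj₂ ∘ proj₂) eq′)
      size≡ = begin
        x + y + z    ≡⟨ reorder x y z ⟨
        x + (z + y)  ≡⟨ cong₂ (λ s t → x + (s + t)) z≡h y≡p ⟩
        x + (h + p)  ≡⟨ to +m≡+n-+k⇔m+k≡n (cong proj₁ eq′) ⟩
        ℓ a r        ∎
    backward : size (x , y , z) ≡ ℓ a r × excess (x , y , z) ≡ ε a r × y < 2 → toℤ³ (x , y , z) ≡ φ a r
    backward (size≡ , excess≡ , y<2) = trans (cong₂ _,_ first (cong₂ (λ s t → + s , + t) y≡p z≡h)) (sym (φ≡ r))
      where
      halves = division-unique 2 y<2 p<2 (trans excess≡ ε≡)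
      z≡h = proj₁ halves
      y≡p = proj₂ halves
      first = from +m≡+n-+k⇔m+k≡n (begin
        x + (h + p)  ≡⟨ cong₂ (λ s t → x + (s + t)) z≡h y≡p ⟨
        x + (z + y)  ≡⟨ reorder x y z ⟩
        x + y + z    ≡⟨ size≡ ⟩
        ℓ a r        ∎)

  ε≤2ℓ⇒φ∈ℕ³ : ∀ r → ε a r ≤ 2 * ℓ a r → InN³ (φ a r)
  ε≤2ℓ⇒φ∈ℕ³ r ε≤2ℓ = (ℓ a r ∸ (h + p) , p , h) , from (toℤ³≡φ⇔ r) (size≡ , sym ε≡ , p<2)
    where
    h = ε a r / 2
    p = ε a r % 2
    p<2 : p < 2
    p<2 = m%n<n (ε a r) 2
    ε≡ : ε a r ≡ 2 * h + p
    ε≡ = m≡n*[m/n]+m%n (ε a r) 2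
    reorder : ∀ d p h → d + p + h ≡ d + (h + p)
    reorder = solve-∀
    size≡ : ℓ a r ∸ (h + p) + p + h ≡ ℓ a r
    size≡ = trans (reorder (ℓ a r ∸ (h + p)) p h) (m∸n+n≡m (half-≤ {h} {p} p<2 (subst (_≤ 2 * ℓ a r) ε≡ ε≤2ℓ)))

  φ-∈F : ∀ r α → toℤ³ α ≡ φ a r → α ∈F[ a ] r
  φ-∈F r (x , y , z) α≡φ with to (toℤ³≡φ⇔ r) α≡φ
  ... | size≡ , excess≡ , _ =
    from (∈F⇔≡a*size+excess {a} {r} (x , y , z)) (trans (r≡a*ℓ+ε r) (cong₂ (λ s e → a * s + e) (sym size≡) (sym excess≡)))

  ℓ≡2κ+ι : ∀ r α → toℤ³ α ≡ φ a r → ℓ a r ≡ 2 * κ α + ι α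
  ℓ≡2κ+ι r α α≡φ = trans (sym (proj₁ (to (toℤ³≡φ⇔ r) α≡φ))) (size≡2κ+ι α)

  φ+jω∈F : ∀ r α → toℤ³ α ≡ φ a r → ∀ j → j ≤ κ α → Σ ℕ³ λ β → toℤ³ β ≡ φ a r + j ω × β ∈F[ a ] r
  φ+jω∈F r α α≡φ j j≤κ = shift α j , trans (toℤ³-shift α j≤κ) (cong (_+ j ω) α≡φ) , shift-∈F α j≤κ (φ-∈F r α α≡φ)

  ∈F⇒shift-of-φ : ∀ {r} → r < 𝓛 a → ∀ α → toℤ³ α ≡ φ a r →
                  ∀ β → β ∈F[ a ] r → Σ ℕ λ j → j ≤ κ α × β ≡ shift α j
  ∈F⇒shift-of-φ {r} r<𝓛 (x , y , z) α≡φ β β∈F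
    with to (toℤ³≡φ⇔ r) α≡φ | to (∈F⇔≡a*size+excess β) β∈F
  ... | sizeα , excessα , y<2 | r≡ with representation-unique r<𝓛 (excess≤2*size β) r≡
  ...   | sizeβ , excessβ = same-size-excess⇒shift β y<2 (trans sizeβ (sym sizeα)) (trans excessβ (sym excessα))

  ∈F⇒φ+jω : ∀ {r} → r < 𝓛 a → ∀ α → toℤ³ α ≡ φ a r →
            ∀ β → β ∈F[ a ] r → Σ ℕ λ j → j ≤ κ α × toℤ³ β ≡ φ a r + j ω
  ∈F⇒φ+jω r<𝓛 α α≡φ β β∈F with ∈F⇒shift-of-φ r<𝓛 α α≡φ β β∈F
  ... | j , j≤κ , refl = j , j≤κ , trans (toℤ³-shift α j≤κ) (cong (_+ j ω) α≡φ)

  ∈F⇒shift-index : ∀ {r} → r < 𝓛 a → ∀ α → toℤ³ α ≡ φ a r →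
                   ∀ β → β ∈F[ a ] r → Σ (Fin (suc (κ α))) λ j → shift α (toℕ j) ≡ β
  ∈F⇒shift-index r<𝓛 α α≡φ β β∈F with ∈F⇒shift-of-φ r<𝓛 α α≡φ β β∈F
  ... | j , j≤κ , refl = fromℕ< (s≤s j≤κ) , cong (shift α) (Fin.toℕ-fromℕ< (s≤s j≤κ))

_≟³_ : DecidableEquality ℕ³
_≟³_ = ≡-dec _≟_ (≡-dec _≟_ _≟_)

module _ {c ℓ′ : Level} (K : Field c ℓ′) where
  open Field K using (Carrier; _≈_; _+K_; _*K_; 0#; 1#)
  module K = Field K
  open Poly K
  open import Algebra.Properties.Semiring.Sum K.semiring using (sum; sum-remove; sum-cong-≋; sum-replicate-zero)
  open import Relation.Binary.Reasoning.Setoid K.setoid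

  sumFin≡sum : ∀ n (f : Fin n → Carrier) → sumFin n f ≡ sum f
  sumFin≡sum zero    f = refl
  sumFin≡sum (suc n) f = cong (f Fin.zero +K_) (sumFin≡sum n (f ∘ Fin.suc))

  sum-zero : ∀ {n} (f : Fin n → Carrier) → (∀ i → f i ≈ 0#) → sum f ≈ 0#
  sum-zero {n} f f≈0 = K.trans (sum-cong-≋ f≈0) (sum-replicate-zero n)

  sum-single : ∀ {n} (f : Fin n → Carrier) j → (∀ i → i ≢ j → f i ≈ 0#) → sum f ≈ f j
  sum-single {suc n} f j f≈0 = begin
    sum f                    ≈⟨ sum-remove {i = j} f ⟩
    f j +K sum (f ∘ punchIn j) ≈⟨ K.+-congˡ (sum-zero _ (λ i → f≈0 (punchIn j i) (Fin.punchInᵢ≢i j i))) ⟩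
    f j +K 0#                ≈⟨ K.+-identityʳ (f j) ⟩
    f j                      ∎

  mono-refl : ∀ α → mono α α ≡ 1#
  mono-refl (x , y , z) with x ≟ x | y ≟ y | z ≟ z
  ... | yes _ | yes _ | yes _ = refl
  ... | no x≢x | _     | _     = ⊥-elim (x≢x refl)
  ... | yes _ | no y≢y | _     = ⊥-elim (y≢y refl)
  ... | yes _ | yes _ | no z≢z = ⊥-elim (z≢z refl)

  mono-≢ : ∀ {α γ} → α ≢ γ → mono α γ ≡ 0#
  mono-≢ {x , y , z} {x′ , y′ , z′} α≢γ with x ≟ x′ | y ≟ y′ | z ≟ z′
  ... | yes refl | yes refl | yes refl = ⊥-elim (α≢γ refl)
  ... | no _     | _        | _        = refl
  ... | yes _    | no _     | _        = refl
  ... | yes _    | yes _    | no _     = refl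

  *mono-≢≈0 : ∀ k {α γ} → α ≢ γ → k *K mono α γ ≈ 0#
  *mono-≢≈0 k α≢γ = K.trans (K.reflexive (cong (k *K_) (mono-≢ α≢γ))) (K.zeroʳ k)

  combo-at : ∀ {n} (b : Fin n → ℕ³) → Injective _≡_ _≡_ b → ∀ cs j → combo n cs b (b j) ≈ cs j
  combo-at {n} b b-injective cs j = begin
    combo n cs b (b j)                     ≡⟨ sumFin≡sum n _ ⟩
    sum (λ i → cs i *K mono (b i) (b j))   ≈⟨ sum-single _ j (λ i i≢j → *mono-≢≈0 (cs i) (i≢j ∘ b-injective)) ⟩
    cs j *K mono (b j) (b j)               ≡⟨ cong (cs j *K_) (mono-refl (b j)) ⟩
    cs j *K 1#                             ≈⟨ K.*-identityʳ (cs j) ⟩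
    cs j                                   ∎

  combo-outside : ∀ {n} (b : Fin n → ℕ³) cs {γ} → (∀ j → b j ≢ γ) → combo n cs b γ ≈ 0#
  combo-outside {n} b cs γ∉b =
    K.trans (K.reflexive (sumFin≡sum n _)) (sum-zero _ (λ i → *mono-≢≈0 (cs i) (γ∉b i)))

  coeff-outside : ∀ {P : ℕ³ → Set} {γ} ts → All (P ∘ proj₂) ts → (∀ {β} → P β → β ≢ γ) → coeff ts γ ≈ 0#
  coeff-outside []             []         _     = K.refl
  coeff-outside ((k , β) ∷ ts) (pβ ∷ pts) γ∉P =
    K.trans (K.+-cong (*mono-≢≈0 k (γ∉P pβ)) (coeff-outside ts pts γ∉P)) (K.+-identityʳ 0#)

  enumeration⇒IsMonomialBasisOfW : ∀ {a r n} (b : Fin n → ℕ³) → Injective _≡_ _≡_ b →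
    (∀ j → b j ∈F[ a ] r) → (∀ β → β ∈F[ a ] r → ∃ λ j → b j ≡ β) → IsMonomialBasisOfW a r n b
  enumeration⇒IsMonomialBasisOfW {a} {r} {n} b b-injective b∈F onto = b∈F , spanning , independent
    where
    spanning : ∀ ts → All (λ t → proj₂ t ∈F[ a ] r) ts →
               Σ (Fin n → Carrier) λ cs → ∀ γ → coeff ts γ ≈ combo n cs b γ
    spanning ts ts∈F = (λ i → coeff ts (b i)) , coeff≈combo
      where
      coeff≈combo : ∀ γ → coeff ts γ ≈ combo n (λ i → coeff ts (b i)) b γ
      coeff≈combo γ with Fin.any? (λ j → b j ≟³ γ)
      ... | yes (j , refl) = K.sym (combo-at b b-injective _ j)
      ... | no γ∉b = K.trans
        (coeff-outside ts ts∈F (λ β∈F β≡γ → γ∉b (proj₁ (onto _ β∈F) , trans (proj₂ (onto _ β∈F)) β≡γ)))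
        (K.sym (combo-outside b _ (λ j bj≡γ → γ∉b (j , bj≡γ))))
    independent : ∀ cs → (∀ γ → combo n cs b γ ≈ 0#) → ∀ j → cs j ≈ 0#
    independent cs combo≈0 j = K.trans (K.sym (combo-at b b-injective cs j)) (combo≈0 (b j))

-- The argument works for every a ≥ 1.
theorem3p1 : {c ℓ′ : Level} (K : Field c ℓ′) (a : ℕ) .{{_ : NonZero a}} → 3 ≤ a → (r : ℕ) →
    -- equivalence of (i) r ∈ S with (ii), (iii), (iv)
    ( (InS a r ⇔ (ε a r ≤ 2 * ℓ a r))
    × (InS a r ⇔ InN³ (φ a r))
    × (InS a r ⇔ Σ ℕ λ u → Σ ℕ λ v → v ≤ 2 * u × r ≡ a * u + v) )
    -- in that case φ_r ∈ F(r,S)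
    × (InS a r → Σ ℕ³ λ α → toℤ³ α ≡ φ a r × α ∈F[ a ] r)
    -- if moreover r < 𝓛_a:
    × (InS a r → r < 𝓛 a →
        -- (1)
        ((u v : ℕ) → v ≤ 2 * u → r ≡ a * u + v → u ≡ ℓ a r × v ≡ ε a r)
        -- (2), (3), (4), where α is φ_r viewed as an element of ℕ³
        × ((α : ℕ³) → toℤ³ α ≡ φ a r →
            -- (2) F(r,S) = { φ_r + jω : 0 ≤ j ≤ κ_r }
            ( ((j : ℕ) → j ≤ κ α →
                 Σ ℕ³ λ β → toℤ³ β ≡ (φ a r) + j ω × β ∈F[ a ] r)
            × ((β : ℕ³) → β ∈F[ a ] r →
                 Σ ℕ λ j → j ≤ κ α × toℤ³ β ≡ (φ a r) + j ω) )
            -- (3) B_r = { m^{φ_r + jω} : 0 ≤ j ≤ κ_r } is a basis of W_r,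
            -- indexed injectively by j ∈ {0,…,κ_r}, so δ_r = κ_r + 1
            × Poly.IsMonomialBasisOfW K a r (suc (κ α))
                (λ j → shift α (toℕ j))
            × ((i j : Fin (suc (κ α))) →
                 shift α (toℕ i) ≡ shift α (toℕ j) → i ≡ j)
            -- (4) ℓ_r = 2(δ_r − 1) + ι_r, same parity, 0 ≤ ι_r ≤ ℓ_r
            × (ℓ a r ≡ 2 * κ α + ι α)
            × (ℓ a r % 2 ≡ ι α % 2)
            × (ι α ≤ ℓ a r)))
theorem3p1 K a _ r =
    ( mk⇔ (iv⇒ii ∘ i⇒iv) (iii⇒i ∘ ii⇒iii)
    , mk⇔ (ii⇒iii ∘ iv⇒ii ∘ i⇒iv) iii⇒i
    , mk⇔ i⇒iv (iii⇒i ∘ ii⇒iii ∘ iv⇒ii) )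
  , (λ r∈S → let (α , α≡φ) = ii⇒iii (iv⇒ii (i⇒iv r∈S)) in α , α≡φ , φ-∈F a r α α≡φ)
  , λ _ r<𝓛 → (λ _ _ → representation-unique a r<𝓛) , λ α α≡φ →
      let ℓ≡ = ℓ≡2κ+ι a r α α≡φ
      in (φ+jω∈F a r α α≡φ , ∈F⇒φ+jω a r<𝓛 α α≡φ)
       , enumeration⇒IsMonomialBasisOfW K _ (Fin.toℕ-injective ∘ shift-injective α)
           (λ j → shift-∈F α (Fin.toℕ≤pred[n] j) (φ-∈F a r α α≡φ)) (∈F⇒shift-index a r<𝓛 α α≡φ)
       , (λ _ _ → Fin.toℕ-injective ∘ shift-injective α)
       , ℓ≡
       , trans (%-congˡ ℓ≡) (%-remove-+ˡ (ι α) (m∣m*n (κ α)))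
       , subst (ι α ≤_) (sym ℓ≡) (m≤n+m (ι α) (2 * κ α))
  where
  i⇒iv = InS⇒representation a
  iv⇒ii = representation⇒ε≤2ℓ a
  ii⇒iii = ε≤2ℓ⇒φ∈ℕ³ a r
  iii⇒i : InN³ (φ a r) → InS a r
  iii⇒i (α , α≡φ) = α , φ-∈F a r α α≡φ
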